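{- Let $N$ be a network and $C$ a connected component of $N$ with $n$ vertices. If $0<\gamma<1$ and $\gamma\binom{n}{2}<1$, then the vertex set of $C$ is a cluster in every CPM($\gamma$)-optimal clustering of $N$. In particular, for all sufficiently small $\gamma>0$, every CPM($\gamma$)-optimal clustering of $N$ has the vertex set of $C$ as a cluster.
   Context: A network is a finite simple undirected unweighted graph $N=(V,E)$; a clustering is a partition of $V$ into nonempty clusters. For $0<\gamma<1$ the CPM($\gamma$) score of a clustering $\mathcal{C}$ is $\mathcal{H}_\gamma(\mathcal{C})=\sum_{c\in\mathcal{C}}\left(e_c-\gamma\binom{|c|}{2}\right)$, where $e_c$ is the number of edges with both endpoints in $c$; a clustering is CPM($\gamma$)-optimal if it maximizes $\mathcal{H}_\gamma$ over all partitions of $V$.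
   Formalization: The parameter γ ranges over the rationals, also in the claim about all sufficiently small γ>0. -}

module Defs where

open import Data.Nat using (ℕ; zero; suc; _+_)
open import Data.Bool using (Bool; true; false; if_then_else_; _∧_)
open import Data.Fin using (Fin; zero; suc; _<?_)
open import Data.Integer using (+_)
open import Data.Rational using (ℚ; _/_; 0ℚ)
import Data.Rational as Q
open import Relation.Binary.PropositionalEquality using (_≡_)
open import Relation.Binary.Construct.Closure.ReflexiveTransitive using (Star)
open import Relation.Nullary.Decidable using (⌊_⌋)
open import Data.Fin using (_≟_)
open import Data.Product using (Σ; _×_)
open import Data.Nat.Combinatorics using (_C_)

count : ∀ {n} → (Fin n → Bool) → ℕ
count {zero} p = 0
count {suc n} p = (if p zero then 1 else 0) + count (λ i → p (suc i))

sumℕ : ∀ {n} → (Fin n → ℕ) → ℕ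
sumℕ {zero} f = 0
sumℕ {suc n} f = f zero + sumℕ (λ i → f (suc i))

sumℚ : ∀ {n} → (Fin n → ℚ) → ℚ
sumℚ {zero} f = 0ℚ
sumℚ {suc n} f = f zero Q.+ sumℚ (λ i → f (suc i))

ℕtoℚ : ℕ → ℚ
ℕtoℚ n = + n / 1

record Network (v : ℕ) : Set where
  field
    adj   : Fin v → Fin v → Bool
    sym   : ∀ x y → adj x y ≡ adj y x
    irrefl : ∀ x → adj x x ≡ false
open Network public

VSet : ℕ → Set
VSet v = Fin v → Bool

Adj : ∀ {v} → Network v → Fin v → Fin v → Set
Adj N x y = adj N x y ≡ true

Reach : ∀ {v} → Network v → Fin v → Fin v → Set
Reach N = Star (Adj N)

IsComponent : ∀ {v} → Network v → VSet v → Set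
IsComponent N S =
  Σ _ (λ r → S r ≡ true)
  × (∀ x y → S x ≡ true → S y ≡ true → Reach N x y)
  × (∀ x y → S x ≡ true → Adj N x y → S y ≡ true)

-- A clustering is a labelling of vertices by labels in Fin v; its clusters are
-- the nonempty fibres. Every partition of Fin v arises this way.
Clustering : ℕ → Set
Clustering v = Fin v → Fin v

sameLabel : ∀ {v} → Fin v → Fin v → Bool
sameLabel a b = ⌊ a ≟ b ⌋

clusterSize : ∀ {v} → Clustering v → Fin v → ℕ
clusterSize c l = count (λ x → sameLabel (c x) l)

clusterEdges : ∀ {v} → Network v → Clustering v → Fin v → ℕ
clusterEdges N c l =
  sumℕ (λ x → count (λ y →
    ⌊ x <? y ⌋ ∧ adj N x y ∧ sameLabel (c x) l ∧ sameLabel (c y) l))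

-- CPM(γ) score: Σ_clusters (e_c − γ·C(|c|,2)); empty label classes contribute 0.
cpm : ∀ {v} → ℚ → Network v → Clustering v → ℚ
cpm γ N c = sumℚ (λ l → ℕtoℚ (clusterEdges N c l)
                        Q.- γ Q.* ℕtoℚ (clusterSize c l C 2))

IsOptimal : ∀ {v} → ℚ → Network v → Clustering v → Set
IsOptimal {v} γ N c = ∀ (c' : Clustering v) → cpm γ N c' Q.≤ cpm γ N c

IsCluster : ∀ {v} → Clustering v → VSet v → Set
IsCluster {v} c S = Σ (Fin v) (λ l → ∀ x → (S x ≡ true → c x ≡ l) × (c x ≡ l → S x ≡ true))

-- Merge the vertex set S of the component into a single cluster and leave the other clusters
-- as they are.  No edge leaves S, so the number of intra-cluster edges grows by the number ΔE of
-- edges of S that were cut, while the number of intra-cluster pairs grows by the number A of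
-- pairs of S that were split and shrinks by the number M of pairs {x, y} with x ∈ S, y ∉ S that
-- shared a cluster.  The score therefore changes by ΔE − γ A + γ M.  If ΔE ≥ 1 this is positive,
-- since γ A ≤ γ C(|S|, 2) < 1.  If ΔE = 0, connectivity puts all of S in one cluster, so A = 0 and
-- the change γ M is positive unless M = 0, that is, unless S is already a cluster.

module Submission where

open import Defs
open import Data.Nat using (ℕ)
open import Data.Nat.Combinatorics using (_C_)
open import Data.Rational using (ℚ; 0ℚ; 1ℚ; _<_; _*_)
open import Data.Product using (Σ; _×_)
open import Relation.Binary.PropositionalEquality using (_≡_)

import Data.Nat as ℕ
open import Data.Nat using (zero; suc)
import Data.Nat.Properties as ℕₚ
open import Data.Nat.Combinatorics using (nC1≡n; nCk+nC[k+1]≡[n+1]C[k+1])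
open import Algebra.Properties.CommutativeMonoid.Sum ℕₚ.+-0-commutativeMonoid
  using (sum; sum-cong-≗; ∑-distrib-+; ∑-comm; sum-replicate-zero)
open import Data.Bool using (Bool; true; false; _∧_; not; _xor_; if_then_else_)
open import Data.Bool.Properties using (∧-comm; ∧-assoc; ∧-zeroʳ; xor-comm)
open import Data.Empty using (⊥-elim)
open import Data.Fin as Fin using (Fin; zero; suc; _<?_; _≟_)
import Data.Fin.Properties as Finₚ
import Data.Integer as ℤ
import Data.Integer.Solver as ℤSolver
open import Data.Maybe as Maybe using (Maybe; just; nothing; fromMaybe)
open import Data.Product using (_,_; proj₁; proj₂; ∃)
import Data.Rational as ℚ
open import Data.Rational using (_+_; _-_; -_; _≤_; 1/_; toℚᵘ)
import Data.Rational.Properties as ℚₚ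
open import Data.Rational.Solver using (module +-*-Solver)
import Data.Rational.Unnormalised as ℚᵘ
import Data.Rational.Unnormalised.Properties as ℚᵘₚ
open import Function using (_∘_; _⇔_; mk⇔)
open import Relation.Binary.Construct.Closure.ReflexiveTransitive as Star using (_◅_)
open import Relation.Binary.Definitions using (tri<; tri≈; tri>)
open import Relation.Binary.PropositionalEquality
  using (refl; cong; cong₂; trans; subst; subst₂; _≢_; module ≡-Reasoning)
import Relation.Binary.PropositionalEquality as ≡
open import Relation.Nullary.Decidable
  using (Dec; ⌊_⌋; yes; no; dec-true; dec-false; does-⇔; isYes≗does)
open import Relation.Nullary.Negation using (¬_; contradiction)

isYes-true : ∀ {a} {A : Set a} (a? : Dec A) → A → ⌊ a? ⌋ ≡ true
isYes-true a? a = trans (isYes≗does a?) (dec-true a? a)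

isYes-false : ∀ {a} {A : Set a} (a? : Dec A) → ¬ A → ⌊ a? ⌋ ≡ false
isYes-false a? ¬a = trans (isYes≗does a?) (dec-false a? ¬a)

isYes-⇔ : ∀ {a b} {A : Set a} {B : Set b} → A ⇔ B → (a? : Dec A) (b? : Dec B) → ⌊ a? ⌋ ≡ ⌊ b? ⌋
isYes-⇔ A⇔B a? b? = trans (isYes≗does a?) (trans (does-⇔ A⇔B a? b?) (≡.sym (isYes≗does b?)))

<?-suc : ∀ {n} (x y : Fin n) → ⌊ suc x <? suc y ⌋ ≡ ⌊ x <? y ⌋
<?-suc x y = isYes-⇔ (mk⇔ ℕ.s<s⁻¹ ℕ.s<s) (suc x <? suc y) (x <? y)

sameLabel-≡ : ∀ {n} {a b : Fin n} → a ≡ b → sameLabel a b ≡ true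
sameLabel-≡ {a = a} {b} = isYes-true (a ≟ b)

sameLabel-≢ : ∀ {n} {a b : Fin n} → a ≢ b → sameLabel a b ≡ false
sameLabel-≢ {a = a} {b} = isYes-false (a ≟ b)

sameLabel⇒≡ : ∀ {n} {a b : Fin n} → sameLabel a b ≡ true → a ≡ b
sameLabel⇒≡ {a = a} {b} h with a ≟ b
... | yes a≡b = a≡b
sameLabel⇒≡ () | no _

sameLabel-sym : ∀ {n} (a b : Fin n) → sameLabel a b ≡ sameLabel b a
sameLabel-sym a b = isYes-⇔ (mk⇔ ≡.sym ≡.sym) (a ≟ b) (b ≟ a)

sameLabel-suc : ∀ {n} (a b : Fin n) → sameLabel (suc a) (suc b) ≡ sameLabel a b
sameLabel-suc a b = isYes-⇔ (mk⇔ Finₚ.suc-injective (cong suc)) (suc a ≟ suc b) (a ≟ b)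

-- Counting unordered pairs

indicator : Bool → ℕ
indicator b = if b then 1 else 0

indicator≤0 : ∀ b → indicator b ℕ.≤ 0 → b ≡ false
indicator≤0 false _ = refl

sumℕ≡sum : ∀ {n} (f : Fin n → ℕ) → sumℕ f ≡ sum f
sumℕ≡sum {zero}  f = refl
sumℕ≡sum {suc n} f = cong (f zero ℕ.+_) (sumℕ≡sum (f ∘ suc))

count≡sum : ∀ {n} (p : Fin n → Bool) → count p ≡ sum (indicator ∘ p)
count≡sum {zero}  p = refl
count≡sum {suc n} p = cong (indicator (p zero) ℕ.+_) (count≡sum (p ∘ suc))

term≤sum : ∀ {n} (f : Fin n → ℕ) i → f i ℕ.≤ sum f
term≤sum f zero    = ℕₚ.m≤m+n _ _
term≤sum f (suc i) = ℕₚ.≤-trans (term≤sum (f ∘ suc) i) (ℕₚ.m≤n+m _ (f zero))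

∑∑-distrib-+ : ∀ {m n} (f g : Fin m → Fin n → ℕ) →
  sum (λ x → sum (λ y → f x y ℕ.+ g x y)) ≡ sum (λ x → sum (f x)) ℕ.+ sum (λ x → sum (g x))
∑∑-distrib-+ f g = trans (sum-cong-≗ λ x → ∑-distrib-+ (f x) (g x))
                         (∑-distrib-+ (λ x → sum (f x)) (λ x → sum (g x)))

pairCount : ∀ {n} → (Fin n → Fin n → Bool) → ℕ
pairCount R = sum λ x → sum λ y → indicator (⌊ x <? y ⌋ ∧ R x y)

pairCount-cong : ∀ {n} {R R′ : Fin n → Fin n → Bool} → (∀ x y → R x y ≡ R′ x y) →
                 pairCount R ≡ pairCount R′
pairCount-cong R≗R′ = sum-cong-≗ λ x → sum-cong-≗ λ y →
  cong (λ b → indicator (⌊ x <? y ⌋ ∧ b)) (R≗R′ x y)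

pairCount-split : ∀ {n} (R B : Fin n → Fin n → Bool) →
  pairCount R ≡ pairCount (λ x y → R x y ∧ B x y) ℕ.+ pairCount (λ x y → R x y ∧ not (B x y))
pairCount-split R B =
  trans (sum-cong-≗ λ x → sum-cong-≗ λ y → split ⌊ x <? y ⌋ (R x y) (B x y))
        (∑∑-distrib-+ (λ x y → indicator (⌊ x <? y ⌋ ∧ R x y ∧ B x y))
                      (λ x y → indicator (⌊ x <? y ⌋ ∧ R x y ∧ not (B x y))))
  where
  split : ∀ l r b → indicator (l ∧ r) ≡ indicator (l ∧ r ∧ b) ℕ.+ indicator (l ∧ r ∧ not b)
  split false r     b     = refl
  split true  false b     = refl
  split true  true  true  = refl
  split true  true  false = refl

pairCount-false : ∀ {n} {R : Fin n → Fin n → Bool} → (∀ x y → R x y ≡ false) → pairCount R ≡ 0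
pairCount-false {n} {R} R≡false =
  trans (sum-cong-≗ λ x → trans (sum-cong-≗ (vanish x)) (sum-replicate-zero n)) (sum-replicate-zero n)
  where
  vanish : ∀ x y → indicator (⌊ x <? y ⌋ ∧ R x y) ≡ 0
  vanish x y rewrite R≡false x y = cong indicator (∧-zeroʳ ⌊ x <? y ⌋)

pairCount≡0-< : ∀ {n} {R : Fin n → Fin n → Bool} → pairCount R ≡ 0 →
                ∀ {x y} → x Fin.< y → R x y ≡ false
pairCount≡0-< {R = R} R0 {x} {y} x<y = indicator≤0 (R x y) (begin
  indicator (R x y)
    ≡⟨ cong (λ l → indicator (l ∧ R x y)) (isYes-true (x <? y) x<y) ⟨
  indicator (⌊ x <? y ⌋ ∧ R x y)
    ≤⟨ term≤sum _ y ⟩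
  sum (λ y → indicator (⌊ x <? y ⌋ ∧ R x y))
    ≤⟨ term≤sum _ x ⟩
  pairCount R
    ≡⟨ R0 ⟩
  0 ∎)
  where open ℕₚ.≤-Reasoning

pairCount≡0-≢ : ∀ {n} {R : Fin n → Fin n → Bool} → (∀ x y → R x y ≡ R y x) → pairCount R ≡ 0 →
                ∀ {x y} → x ≢ y → R x y ≡ false
pairCount≡0-≢ {R = R} R-sym R0 {x} {y} x≢y with Finₚ.<-cmp x y
... | tri< x<y _ _ = pairCount≡0-< R0 x<y
... | tri≈ _ x≡y _ = ⊥-elim (x≢y x≡y)
... | tri> _ _ y<x = trans (R-sym x y) (pairCount≡0-< R0 y<x)

choose2-suc : ∀ u k → (if u then k else 0) ℕ.+ k C 2 ≡ (indicator u ℕ.+ k) C 2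
choose2-suc true  k = trans (cong (ℕ._+ k C 2) (≡.sym (nC1≡n k))) (nCk+nC[k+1]≡[n+1]C[k+1] k 1)
choose2-suc false k = refl

sum-indicator-∧ : ∀ {n} u (w : Fin n → Bool) →
                  sum (λ i → indicator (u ∧ w i)) ≡ (if u then count w else 0)
sum-indicator-∧ true  w = ≡.sym (count≡sum w)
sum-indicator-∧ {n} false w = sum-replicate-zero n

pairCount-∧ : ∀ {n} (p : Fin n → Bool) → pairCount (λ x y → p x ∧ p y) ≡ count p C 2
pairCount-∧ {zero}  p = refl
pairCount-∧ {suc n} p = begin
  sum (λ j → indicator (p zero ∧ p (suc j)))
    ℕ.+ sum (λ x → sum (λ y → indicator (⌊ suc x <? suc y ⌋ ∧ p (suc x) ∧ p (suc y))))
    ≡⟨ cong₂ ℕ._+_ (sum-indicator-∧ (p zero) (p ∘ suc))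
                   (trans (sum-cong-≗ λ x → sum-cong-≗ λ y →
                             cong (λ l → indicator (l ∧ p (suc x) ∧ p (suc y))) (<?-suc x y))
                          (pairCount-∧ (p ∘ suc))) ⟩
  (if p zero then count (p ∘ suc) else 0) ℕ.+ count (p ∘ suc) C 2
    ≡⟨ choose2-suc (p zero) (count (p ∘ suc)) ⟩
  count p C 2 ∎
  where open ≡-Reasoning

sum-sameLabel : ∀ {n} (a b : Fin n) →
                sum (λ l → indicator (sameLabel a l ∧ sameLabel b l)) ≡ indicator (sameLabel a b)
sum-sameLabel {suc n} zero    zero    = cong suc (sum-replicate-zero n)
sum-sameLabel {suc n} zero    (suc b) = sum-replicate-zero n
sum-sameLabel {suc n} (suc a) zero    =
  trans (sum-cong-≗ λ l → cong indicator (∧-zeroʳ (sameLabel (suc a) (suc l)))) (sum-replicate-zero n)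
sum-sameLabel {suc n} (suc a) (suc b) = begin
  sum (λ l → indicator (sameLabel (suc a) (suc l) ∧ sameLabel (suc b) (suc l)))
    ≡⟨ sum-cong-≗ (λ l → cong₂ (λ s t → indicator (s ∧ t)) (sameLabel-suc a l) (sameLabel-suc b l)) ⟩
  sum (λ l → indicator (sameLabel a l ∧ sameLabel b l))
    ≡⟨ sum-sameLabel a b ⟩
  indicator (sameLabel a b)
    ≡⟨ cong indicator (sameLabel-suc a b) ⟨
  indicator (sameLabel (suc a) (suc b)) ∎
  where open ≡-Reasoning

∑-pairCount-label : ∀ {m n} (R : Fin n → Fin n → Bool) (c : Fin n → Fin m) →
  sum (λ l → pairCount (λ x y → R x y ∧ sameLabel (c x) l ∧ sameLabel (c y) l))
    ≡ pairCount (λ x y → R x y ∧ sameLabel (c x) (c y))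
∑-pairCount-label {m} R c = begin
  sum (λ l → sum (λ x → sum (λ y → term l x y)))
    ≡⟨ ∑-comm (λ l x → sum (term l x)) ⟩
  sum (λ x → sum (λ l → sum (λ y → term l x y)))
    ≡⟨ sum-cong-≗ (λ x → ∑-comm (λ l y → term l x y)) ⟩
  sum (λ x → sum (λ y → sum (λ l → term l x y)))
    ≡⟨ sum-cong-≗ (λ x → sum-cong-≗ λ y → collapse ⌊ x <? y ⌋ (R x y) (c x) (c y)) ⟩
  pairCount (λ x y → R x y ∧ sameLabel (c x) (c y)) ∎
  where
  open ≡-Reasoning
  term : Fin m → _ → _ → ℕ
  term l x y = indicator (⌊ x <? y ⌋ ∧ R x y ∧ sameLabel (c x) l ∧ sameLabel (c y) l)
  collapse : ∀ u r a b → sum (λ l → indicator (u ∧ r ∧ sameLabel a l ∧ sameLabel b l))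
                           ≡ indicator (u ∧ r ∧ sameLabel a b)
  collapse false r     a b = sum-replicate-zero m
  collapse true  false a b = sum-replicate-zero m
  collapse true  true  a b = sum-sameLabel a b

-- Rational arithmetic

ℕtoℚ-+ : ∀ m n → ℕtoℚ (m ℕ.+ n) ≡ ℕtoℚ m + ℕtoℚ n
ℕtoℚ-+ m n = ℚₚ.toℚᵘ-injective (begin
  toℚᵘ (ℕtoℚ (m ℕ.+ n))                ≈⟨ ℚₚ.toℚᵘ-fromℚᵘ (m/1 (m ℕ.+ n)) ⟩
  m/1 (m ℕ.+ n)                         ≈⟨ ℚᵘ.*≡* (solve 2 (λ a b → (a :+ b) :* con 1ℤ
                                                   := (a :* con 1ℤ :+ b :* con 1ℤ) :* con 1ℤ)
                                                   refl (ℤ.+ m) (ℤ.+ n)) ⟩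
  m/1 m ℚᵘ.+ m/1 n                      ≈⟨ ℚᵘₚ.+-cong (ℚᵘₚ.≃-sym (ℚₚ.toℚᵘ-fromℚᵘ (m/1 m)))
                                                      (ℚᵘₚ.≃-sym (ℚₚ.toℚᵘ-fromℚᵘ (m/1 n))) ⟩
  toℚᵘ (ℕtoℚ m) ℚᵘ.+ toℚᵘ (ℕtoℚ n)     ≈⟨ ℚₚ.toℚᵘ-homo-+ (ℕtoℚ m) (ℕtoℚ n) ⟨
  toℚᵘ (ℕtoℚ m + ℕtoℚ n)                ∎)
  where
  open ℚᵘₚ.≃-Reasoning
  open ℤSolver.+-*-Solver
  1ℤ = ℤ.+ 1
  m/1 : ℕ → ℚᵘ.ℚᵘ
  m/1 k = ℚᵘ.mkℚᵘ (ℤ.+ k) 0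

ℕtoℚ-nonNeg : ∀ n → 0ℚ ≤ ℕtoℚ n
ℕtoℚ-nonNeg n = ℚₚ.nonNegative⁻¹ (ℕtoℚ n) {{ℚₚ.normalize-nonNeg n 1}}

ℕtoℚ-mono-≤ : ∀ {m n} → m ℕ.≤ n → ℕtoℚ m ≤ ℕtoℚ n
ℕtoℚ-mono-≤ {m} {n} m≤n = begin
  ℕtoℚ m                       ≡⟨ ℚₚ.+-identityʳ (ℕtoℚ m) ⟨
  ℕtoℚ m + 0ℚ                  ≤⟨ ℚₚ.+-monoʳ-≤ (ℕtoℚ m) (ℕtoℚ-nonNeg (n ℕ.∸ m)) ⟩
  ℕtoℚ m + ℕtoℚ (n ℕ.∸ m)      ≡⟨ ℕtoℚ-+ m (n ℕ.∸ m) ⟨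
  ℕtoℚ (m ℕ.+ (n ℕ.∸ m))       ≡⟨ cong ℕtoℚ (ℕₚ.m+[n∸m]≡n m≤n) ⟩
  ℕtoℚ n                       ∎
  where open ℚₚ.≤-Reasoning

sumℚ-affine : ∀ {n} γ (f g : Fin n → ℕ) →
  sumℚ (λ l → ℕtoℚ (f l) - γ * ℕtoℚ (g l)) ≡ ℕtoℚ (sumℕ f) - γ * ℕtoℚ (sumℕ g)
sumℚ-affine {zero}  γ f g = solve 1 (λ γ → con 0ℚ := con 0ℚ :- γ :* con 0ℚ) refl γ
  where open +-*-Solver
sumℚ-affine {suc n} γ f g = begin
  (ℕtoℚ (f zero) - γ * ℕtoℚ (g zero)) + sumℚ (λ l → ℕtoℚ (f (suc l)) - γ * ℕtoℚ (g (suc l)))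
    ≡⟨ cong ((ℕtoℚ (f zero) - γ * ℕtoℚ (g zero)) +_) (sumℚ-affine γ (f ∘ suc) (g ∘ suc)) ⟩
  (ℕtoℚ (f zero) - γ * ℕtoℚ (g zero)) + (ℕtoℚ (sumℕ (f ∘ suc)) - γ * ℕtoℚ (sumℕ (g ∘ suc)))
    ≡⟨ solve 5 (λ a b c d γ → (a :- γ :* b) :+ (c :- γ :* d) := (a :+ c) :- γ :* (b :+ d)) refl
         (ℕtoℚ (f zero)) (ℕtoℚ (g zero)) (ℕtoℚ (sumℕ (f ∘ suc))) (ℕtoℚ (sumℕ (g ∘ suc))) γ ⟩
  (ℕtoℚ (f zero) + ℕtoℚ (sumℕ (f ∘ suc))) - γ * (ℕtoℚ (g zero) + ℕtoℚ (sumℕ (g ∘ suc)))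
    ≡⟨ cong₂ (λ a b → a - γ * b) (ℕtoℚ-+ (f zero) _) (ℕtoℚ-+ (g zero) _) ⟨
  ℕtoℚ (sumℕ f) - γ * ℕtoℚ (sumℕ g) ∎
  where
  open ≡-Reasoning
  open +-*-Solver

score-gain : ∀ γ P ΔP X A M → γ * A < ΔP + γ * M →
             P - γ * (X + M) < (P + ΔP) - γ * (X + A)
score-gain γ P ΔP X A M γA<gain = begin-strict
  P - γ * (X + M)                          ≡⟨ ℚₚ.+-identityʳ _ ⟨
  (P - γ * (X + M)) + 0ℚ                   <⟨ ℚₚ.+-monoʳ-< (P - γ * (X + M)) gain>0 ⟩
  (P - γ * (X + M)) + (ΔP + γ * M - γ * A) ≡⟨ solve 6 (λ γ P ΔP X A M →
      (P :- γ :* (X :+ M)) :+ (ΔP :+ γ :* M :- γ :* A) := (P :+ ΔP) :- γ :* (X :+ A)) refl γ P ΔP X A M ⟩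
  (P + ΔP) - γ * (X + A)                   ∎
  where
  open ℚₚ.≤-Reasoning
  open +-*-Solver
  gain>0 : 0ℚ < ΔP + γ * M - γ * A
  gain>0 = subst (_< ΔP + γ * M - γ * A) (ℚₚ.+-inverseʳ (γ * A)) (ℚₚ.+-monoˡ-< (- (γ * A)) γA<gain)

*-monoˡ-≤-pos : ∀ {γ} → 0ℚ < γ → ∀ {p q} → p ≤ q → γ * p ≤ γ * q
*-monoˡ-≤-pos {γ} 0<γ = ℚₚ.*-monoˡ-≤-nonNeg γ {{ℚₚ.pos⇒nonNeg γ {{ℚ.positive 0<γ}}}}

gain-from-edges : ∀ {γ} {A K ΔP} M → 0ℚ < γ → A ℕ.≤ K → γ * ℕtoℚ K < 1ℚ → 1 ℕ.≤ ΔP →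
                  γ * ℕtoℚ A < ℕtoℚ ΔP + γ * ℕtoℚ M
gain-from-edges {γ} {A} {K} {ΔP} M 0<γ A≤K γK<1 1≤ΔP = begin-strict
  γ * ℕtoℚ A               ≤⟨ *-monoˡ-≤-pos 0<γ (ℕtoℚ-mono-≤ A≤K) ⟩
  γ * ℕtoℚ K               <⟨ γK<1 ⟩
  ℕtoℚ 1                   ≤⟨ ℕtoℚ-mono-≤ 1≤ΔP ⟩
  ℕtoℚ ΔP                  ≡⟨ ℚₚ.+-identityʳ (ℕtoℚ ΔP) ⟨
  ℕtoℚ ΔP + 0ℚ             ≤⟨ ℚₚ.+-monoʳ-≤ (ℕtoℚ ΔP) γM≥0 ⟩
  ℕtoℚ ΔP + γ * ℕtoℚ M     ∎
  where
  open ℚₚ.≤-Reasoning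
  γM≥0 : 0ℚ ≤ γ * ℕtoℚ M
  γM≥0 = subst (_≤ γ * ℕtoℚ M) (ℚₚ.*-zeroʳ γ) (*-monoˡ-≤-pos 0<γ (ℕtoℚ-nonNeg M))

gain-from-strays : ∀ {γ M} → 0ℚ < γ → 1 ℕ.≤ M → γ * ℕtoℚ 0 < ℕtoℚ 0 + γ * ℕtoℚ M
gain-from-strays {γ} {M} 0<γ 1≤M = begin-strict
  γ * 0ℚ             <⟨ ℚₚ.*-monoʳ-<-pos γ {{ℚ.positive 0<γ}} 0<M ⟩
  γ * ℕtoℚ M         ≡⟨ ℚₚ.+-identityˡ (γ * ℕtoℚ M) ⟨
  0ℚ + γ * ℕtoℚ M    ∎
  where
  open ℚₚ.≤-Reasoning
  0<M : 0ℚ < ℕtoℚ M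
  0<M = ℚₚ.<-≤-trans (ℚₚ.positive⁻¹ 1ℚ) (ℕtoℚ-mono-≤ 1≤M)

small-γ : ∀ K → Σ ℚ (λ ε → 0ℚ < ε × (∀ γ → 0ℚ < γ → γ < ε → γ * ℕtoℚ K < 1ℚ))
small-γ K = 1/ p , ℚₚ.positive⁻¹ (1/ p) {{ℚₚ.1/pos⇒pos p}} , λ γ 0<γ γ<ε → begin-strict
  γ * ℕtoℚ K       ≤⟨ *-monoˡ-≤-pos 0<γ (ℕtoℚ-mono-≤ (ℕₚ.n≤1+n K)) ⟩
  γ * p            <⟨ ℚₚ.*-monoˡ-<-pos p γ<ε ⟩
  1/ p * p         ≡⟨ ℚₚ.*-inverseˡ p ⟩
  1ℚ               ∎
  where
  open ℚₚ.≤-Reasoning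
  p = ℕtoℚ (suc K)
  instance
    p-pos : ℚ.Positive p
    p-pos = ℚₚ.normalize-pos (suc K) 1
    p≢0 : ℚ.NonZero p
    p≢0 = ℚₚ.pos⇒nonZero p

-- The CPM score in terms of pair counts

sameCluster : ∀ {v} → Clustering v → Fin v → Fin v → Bool
sameCluster c x y = sameLabel (c x) (c y)

intraPairs : ∀ {v} → Clustering v → ℕ
intraPairs c = pairCount (sameCluster c)

intraEdges : ∀ {v} → Network v → Clustering v → ℕ
intraEdges N c = pairCount (λ x y → adj N x y ∧ sameCluster c x y)

∑-clusterEdges : ∀ {v} (N : Network v) (c : Clustering v) → sumℕ (clusterEdges N c) ≡ intraEdges N c
∑-clusterEdges N c = begin
  sumℕ (clusterEdges N c)
    ≡⟨ sumℕ≡sum (clusterEdges N c) ⟩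
  sum (clusterEdges N c)
    ≡⟨ sum-cong-≗ (λ l → trans (sumℕ≡sum (λ x → count (edge l x)))
                               (sum-cong-≗ λ x → count≡sum (edge l x))) ⟩
  sum (λ l → pairCount (λ x y → adj N x y ∧ sameLabel (c x) l ∧ sameLabel (c y) l))
    ≡⟨ ∑-pairCount-label (adj N) c ⟩
  intraEdges N c ∎
  where
  open ≡-Reasoning
  edge : _ → _ → _ → Bool
  edge l x y = ⌊ x <? y ⌋ ∧ adj N x y ∧ sameLabel (c x) l ∧ sameLabel (c y) l

∑-clusterSize-C2 : ∀ {v} (c : Clustering v) → sumℕ (λ l → clusterSize c l C 2) ≡ intraPairs c
∑-clusterSize-C2 c = begin
  sumℕ (λ l → clusterSize c l C 2)
    ≡⟨ sumℕ≡sum (λ l → clusterSize c l C 2) ⟩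
  sum (λ l → clusterSize c l C 2)
    ≡⟨ sum-cong-≗ (λ l → pairCount-∧ (λ x → sameLabel (c x) l)) ⟨
  sum (λ l → pairCount (λ x y → true ∧ sameLabel (c x) l ∧ sameLabel (c y) l))
    ≡⟨ ∑-pairCount-label (λ _ _ → true) c ⟩
  intraPairs c ∎
  where open ≡-Reasoning

cpm≡ : ∀ {v} γ (N : Network v) (c : Clustering v) →
       cpm γ N c ≡ ℕtoℚ (intraEdges N c) - γ * ℕtoℚ (intraPairs c)
cpm≡ γ N c = trans (sumℚ-affine γ (clusterEdges N c) (λ l → clusterSize c l C 2))
                   (cong₂ (λ e p → ℕtoℚ e - γ * ℕtoℚ p) (∑-clusterEdges N c) (∑-clusterSize-C2 c))

-- Merging a vertex set into one cluster

firstTrue : ∀ {n} → (Fin n → Bool) → Maybe (Fin n)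
firstTrue {zero}  p = nothing
firstTrue {suc n} p = if p zero then just zero else Maybe.map suc (firstTrue (p ∘ suc))

firstTrue-cong : ∀ {n} {p q : Fin n → Bool} → (∀ i → p i ≡ q i) → firstTrue p ≡ firstTrue q
firstTrue-cong {zero}  p≗q = refl
firstTrue-cong {suc n} p≗q =
  cong₂ (λ b m → if b then just zero else Maybe.map suc m) (p≗q zero) (firstTrue-cong (p≗q ∘ suc))

firstTrue-complete : ∀ {n} (p : Fin n → Bool) {i} → p i ≡ true →
                     ∃ λ j → firstTrue p ≡ just j × p j ≡ true
firstTrue-complete {suc n} p {i} pi with p zero in p0
... | true = zero , refl , p0
firstTrue-complete {suc n} p {zero}  pi | false = contradiction (trans (≡.sym p0) pi) λ ()
firstTrue-complete {suc n} p {suc i} pi | false with firstTrue-complete (p ∘ suc) pi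
... | j , found , pj = suc j , cong (Maybe.map suc) found , pj

-- A reflexive Boolean relation whose related elements have equal rows is an equivalence;
-- labelling each element by the first element of its class realises it as a clustering.
module Representatives {n} (E : Fin n → Fin n → Bool)
                       (E-refl : ∀ x → E x x ≡ true)
                       (E-rows : ∀ {x y} → E x y ≡ true → ∀ z → E x z ≡ E y z) where

  representative : Fin n → Fin n
  representative x = fromMaybe x (firstTrue (E x))

  representative-≡ : ∀ {x j} → firstTrue (E x) ≡ just j → representative x ≡ j
  representative-≡ {x} = cong (fromMaybe x)

  E-representative : ∀ x → E x (representative x) ≡ true
  E-representative x =
    let j , found , Exj = firstTrue-complete (E x) (E-refl x) in
    subst (λ r → E x r ≡ true) (≡.sym (representative-≡ found)) Exj

  representative-cong : ∀ {x y} → E x y ≡ true → representative x ≡ representative y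
  representative-cong {x} {y} Exy =
    let j , found , _ = firstTrue-complete (E y) (E-refl y) in
    trans (representative-≡ (trans (firstTrue-cong (E-rows Exy)) found)) (≡.sym (representative-≡ found))

  representative-related : ∀ {x y} → representative x ≡ representative y → E x y ≡ true
  representative-related {x} {y} same = begin
    E x y                   ≡⟨ E-rows (E-representative x) y ⟩
    E (representative x) y  ≡⟨ cong (λ r → E r y) same ⟩
    E (representative y) y  ≡⟨ E-rows (E-representative y) y ⟨
    E y y                   ≡⟨ E-refl y ⟩
    true                    ∎
    where open ≡-Reasoning

  sameLabel-representative : ∀ x y → sameLabel (representative x) (representative y) ≡ E x y
  sameLabel-representative x y with E x y in Exy
  ... | true  = sameLabel-≡ (representative-cong Exy)
  ... | false = sameLabel-≢ λ same → contradiction (trans (≡.sym (representative-related same)) Exy) λ ()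

-- Whether two vertices share a cluster once S is merged, where s and t say whether they lie
-- in S and e whether they shared a cluster before.
merged : Bool → Bool → Bool → Bool
merged s t e = if s then t else not t ∧ e

merged-refl : ∀ {n} s (a : Fin n) → merged s s (sameLabel a a) ≡ true
merged-refl true  a = refl
merged-refl false a = sameLabel-≡ refl

merged-rows : ∀ {n} s t u {a b d : Fin n} → merged s t (sameLabel a b) ≡ true →
              merged s u (sameLabel a d) ≡ merged t u (sameLabel b d)
merged-rows true  true  u h = refl
merged-rows true  false u ()
merged-rows false true  u ()
merged-rows false false u {d = d} h = cong (λ r → merged false u (sameLabel r d)) (sameLabel⇒≡ h)

merged-∧-not : ∀ s t e → merged s t e ∧ not e ≡ (s ∧ t) ∧ not e
merged-∧-not true  t     e     = refl
merged-∧-not false true  e     = refl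
merged-∧-not false false true  = refl
merged-∧-not false false false = refl

∧-not-merged : ∀ s t e → e ∧ not (merged s t e) ≡ (s xor t) ∧ e
∧-not-merged true  true  e     = ∧-zeroʳ e
∧-not-merged true  false e     = ∧-comm e true
∧-not-merged false true  e     = ∧-comm e true
∧-not-merged false false true  = refl
∧-not-merged false false false = refl

∧-merged-∧ : ∀ a s t e → (a ≡ true → s ≡ t) → (a ∧ merged s t e) ∧ e ≡ a ∧ e
∧-merged-∧ false s     t e     _   = refl
∧-merged-∧ true  s     t e     s≡t with s≡t refl
∧-merged-∧ true  true  _ e     _ | refl = refl
∧-merged-∧ true  false _ true  _ | refl = refl
∧-merged-∧ true  false _ false _ | refl = refl

module _ {v} (S : VSet v) (c : Clustering v) where

  mergedRel : Fin v → Fin v → Bool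
  mergedRel x y = merged (S x) (S y) (sameCluster c x y)

  private
    module Merged = Representatives mergedRel (λ x → merged-refl (S x) (c x))
                      (λ {x} {y} h z → merged-rows (S x) (S y) (S z) h)

  mergeInto : Clustering v
  mergeInto = Merged.representative

  sameCluster-mergeInto : ∀ x y → sameCluster mergeInto x y ≡ mergedRel x y
  sameCluster-mergeInto = Merged.sameLabel-representative

  commonPairs : ℕ
  commonPairs = pairCount (λ x y → sameCluster c x y ∧ mergedRel x y)

  strayPairs : ℕ
  strayPairs = pairCount (λ x y → (S x xor S y) ∧ sameCluster c x y)

  brokenPairs : ℕ
  brokenPairs = pairCount (λ x y → (S x ∧ S y) ∧ not (sameCluster c x y))

  brokenEdges : Network v → ℕ
  brokenEdges N = pairCount (λ x y → adj N x y ∧ (S x ∧ S y) ∧ not (sameCluster c x y))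

  intraPairs≡common+stray : intraPairs c ≡ commonPairs ℕ.+ strayPairs
  intraPairs≡common+stray =
    trans (pairCount-split (sameCluster c) mergedRel)
          (cong (commonPairs ℕ.+_) (pairCount-cong λ x y → ∧-not-merged (S x) (S y) (sameCluster c x y)))

  intraPairs-mergeInto : intraPairs mergeInto ≡ commonPairs ℕ.+ brokenPairs
  intraPairs-mergeInto = begin
    intraPairs mergeInto
      ≡⟨ pairCount-cong sameCluster-mergeInto ⟩
    pairCount mergedRel
      ≡⟨ pairCount-split mergedRel (sameCluster c) ⟩
    pairCount (λ x y → mergedRel x y ∧ sameCluster c x y)
      ℕ.+ pairCount (λ x y → mergedRel x y ∧ not (sameCluster c x y))
      ≡⟨ cong₂ ℕ._+_ (pairCount-cong λ x y → ∧-comm (mergedRel x y) (sameCluster c x y))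
                     (pairCount-cong λ x y → merged-∧-not (S x) (S y) (sameCluster c x y)) ⟩
    commonPairs ℕ.+ brokenPairs ∎
    where open ≡-Reasoning

  intraEdges-mergeInto : (N : Network v) → (∀ x y → Adj N x y → S x ≡ S y) →
                         intraEdges N mergeInto ≡ intraEdges N c ℕ.+ brokenEdges N
  intraEdges-mergeInto N Adj⇒S≡ = begin
    intraEdges N mergeInto
      ≡⟨ pairCount-cong (λ x y → cong (adj N x y ∧_) (sameCluster-mergeInto x y)) ⟩
    pairCount (λ x y → adj N x y ∧ mergedRel x y)
      ≡⟨ pairCount-split _ (sameCluster c) ⟩
    pairCount (λ x y → (adj N x y ∧ mergedRel x y) ∧ sameCluster c x y)
      ℕ.+ pairCount (λ x y → (adj N x y ∧ mergedRel x y) ∧ not (sameCluster c x y))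
      ≡⟨ cong₂ ℕ._+_ (pairCount-cong λ x y → ∧-merged-∧ (adj N x y) (S x) (S y) (sameCluster c x y)
                                                          (Adj⇒S≡ x y))
                     (pairCount-cong λ x y → trans (∧-assoc (adj N x y) _ _)
                        (cong (adj N x y ∧_) (merged-∧-not (S x) (S y) (sameCluster c x y)))) ⟩
    intraEdges N c ℕ.+ brokenEdges N ∎
    where open ≡-Reasoning

  brokenPairs≤ : brokenPairs ℕ.≤ count S C 2
  brokenPairs≤ = begin
    brokenPairs
      ≤⟨ ℕₚ.m≤n+m brokenPairs _ ⟩
    pairCount (λ x y → (S x ∧ S y) ∧ sameCluster c x y) ℕ.+ brokenPairs
      ≡⟨ pairCount-split (λ x y → S x ∧ S y) (sameCluster c) ⟨
    pairCount (λ x y → S x ∧ S y)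
      ≡⟨ pairCount-∧ S ⟩
    count S C 2 ∎
    where open ℕₚ.≤-Reasoning

  mergeInto-gain : ∀ {γ} (N : Network v) → (∀ x y → Adj N x y → S x ≡ S y) →
    γ * ℕtoℚ brokenPairs < ℕtoℚ (brokenEdges N) + γ * ℕtoℚ strayPairs →
    cpm γ N c < cpm γ N mergeInto
  mergeInto-gain {γ} N Adj⇒S≡ gain = subst₂ _<_ (≡.sym before) (≡.sym after)
    (score-gain γ (q (intraEdges N c)) (q (brokenEdges N))
                  (q commonPairs) (q brokenPairs) (q strayPairs) gain)
    where
    q = ℕtoℚ
    before : cpm γ N c ≡ q (intraEdges N c) - γ * (q commonPairs + q strayPairs)
    before = trans (cpm≡ γ N c)
      (cong (λ p → q (intraEdges N c) - γ * p)
            (trans (cong q intraPairs≡common+stray) (ℕtoℚ-+ commonPairs strayPairs)))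
    after : cpm γ N mergeInto
          ≡ (q (intraEdges N c) + q (brokenEdges N)) - γ * (q commonPairs + q brokenPairs)
    after = trans (cpm≡ γ N mergeInto)
      (cong₂ (λ e p → e - γ * p)
             (trans (cong q (intraEdges-mergeInto N Adj⇒S≡)) (ℕtoℚ-+ (intraEdges N c) (brokenEdges N)))
             (trans (cong q intraPairs-mergeInto) (ℕtoℚ-+ commonPairs brokenPairs)))

-- Connected components

module _ {v} (N : Network v) (S : VSet v) (component : IsComponent N S) where

  private
    root : Fin v
    root = proj₁ (proj₁ component)

    S-root : S root ≡ true
    S-root = proj₂ (proj₁ component)

    S-connected : ∀ x y → S x ≡ true → S y ≡ true → Reach N x y
    S-connected = proj₁ (proj₂ component)

    S-closed : ∀ x y → S x ≡ true → Adj N x y → S y ≡ true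
    S-closed = proj₂ (proj₂ component)

  Adj⇒S≡ : ∀ x y → Adj N x y → S x ≡ S y
  Adj⇒S≡ x y x~y with S x in Sx | S y in Sy
  ... | true  | true  = refl
  ... | false | false = refl
  ... | true  | false = trans (≡.sym (S-closed x y Sx x~y)) Sy
  ... | false | true  = trans (≡.sym Sx) (S-closed y x Sy (trans (Network.sym N y x) x~y))

  module _ (c : Clustering v) where

    private
      brokenEdge-sym : ∀ x y → adj N x y ∧ (S x ∧ S y) ∧ not (sameCluster c x y)
                             ≡ adj N y x ∧ (S y ∧ S x) ∧ not (sameCluster c y x)
      brokenEdge-sym x y = cong₂ _∧_ (Network.sym N x y)
        (cong₂ _∧_ (∧-comm (S x) (S y)) (cong not (sameLabel-sym (c x) (c y))))

      unbroken : ∀ {a s t e} → a ≡ true → s ≡ true → t ≡ true → a ∧ (s ∧ t) ∧ not e ≡ false → e ≡ true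
      unbroken {e = true} refl refl refl _ = refl

    edge-in-cluster : brokenEdges S c N ≡ 0 → ∀ {x y} → S x ≡ true → Adj N x y → c x ≡ c y
    edge-in-cluster no-broken {x} {y} Sx x~y = sameLabel⇒≡ (unbroken x~y Sx (S-closed x y Sx x~y)
      (pairCount≡0-≢ brokenEdge-sym no-broken x≢y))
      where
      x≢y : x ≢ y
      x≢y refl = contradiction (trans (≡.sym x~y) (irrefl N x)) λ ()

    path-in-cluster : brokenEdges S c N ≡ 0 → ∀ {x y} → Reach N x y → S x ≡ true → c x ≡ c y
    path-in-cluster no-broken Star.ε             Sx = refl
    path-in-cluster no-broken (_◅_ {j = z} x~z z⇝y) Sx =
      trans (edge-in-cluster no-broken Sx x~z) (path-in-cluster no-broken z⇝y (S-closed _ z Sx x~z))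

    S-in-cluster : brokenEdges S c N ≡ 0 → ∀ x → S x ≡ true → c x ≡ c root
    S-in-cluster no-broken x Sx = path-in-cluster no-broken (S-connected x root Sx S-root) Sx

    no-brokenPairs : brokenEdges S c N ≡ 0 → brokenPairs S c ≡ 0
    no-brokenPairs no-broken = pairCount-false together
      where
      together : ∀ x y → (S x ∧ S y) ∧ not (sameCluster c x y) ≡ false
      together x y with S x in Sx | S y in Sy
      ... | false | _     = refl
      ... | true  | false = refl
      ... | true  | true  = cong not (sameLabel-≡ (trans (S-in-cluster no-broken x Sx)
                                                         (≡.sym (S-in-cluster no-broken y Sy))))

    cluster-in-S : strayPairs S c ≡ 0 → ∀ x → c x ≡ c root → S x ≡ true
    cluster-in-S no-stray x cx≡cr with S x in Sx
    ... | true  = refl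
    ... | false = ⊥-elim (stray Sx S-root (sameLabel-≡ cx≡cr) (pairCount≡0-≢ stray-sym no-stray x≢root))
      where
      stray : ∀ {s t e} → s ≡ false → t ≡ true → e ≡ true → (s xor t) ∧ e ≢ false
      stray refl refl refl ()
      stray-sym : ∀ x y → (S x xor S y) ∧ sameCluster c x y ≡ (S y xor S x) ∧ sameCluster c y x
      stray-sym x y = cong₂ _∧_ (xor-comm (S x) (S y)) (sameLabel-sym (c x) (c y))
      x≢root : x ≢ root
      x≢root refl = contradiction (trans (≡.sym Sx) S-root) λ ()

    component-cluster : brokenEdges S c N ≡ 0 → strayPairs S c ≡ 0 → IsCluster c S
    component-cluster no-broken no-stray =
      c root , λ x → S-in-cluster no-broken x , cluster-in-S no-stray x

  optimal⇒no-gain : ∀ {γ c} → IsOptimal γ N c →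
    ¬ (γ * ℕtoℚ (brokenPairs S c) < ℕtoℚ (brokenEdges S c N) + γ * ℕtoℚ (strayPairs S c))
  optimal⇒no-gain {γ} {c} optimal gain =
    ℚₚ.<-irrefl refl (ℚₚ.<-≤-trans (mergeInto-gain S c {γ} N Adj⇒S≡ gain) (optimal (mergeInto S c)))

  optimal⇒cluster : ∀ {γ} → 0ℚ < γ → γ * ℕtoℚ (count S C 2) < 1ℚ →
                    (c : Clustering v) → IsOptimal γ N c → IsCluster c S
  optimal⇒cluster {γ} 0<γ γK<1 c optimal = by-cases (brokenEdges S c N ℕ.≟ 0) (strayPairs S c ℕ.≟ 0)
    where
    by-cases : Dec (brokenEdges S c N ≡ 0) → Dec (strayPairs S c ≡ 0) → IsCluster c S
    by-cases (no broken≢0) _ = contradiction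
      (gain-from-edges (strayPairs S c) 0<γ (brokenPairs≤ S c) γK<1 (ℕₚ.n≢0⇒n>0 broken≢0))
      (optimal⇒no-gain {γ} {c} optimal)
    by-cases (yes broken≡0) (no stray≢0) = contradiction
      (subst₂ (λ A ΔP → γ * ℕtoℚ A < ℕtoℚ ΔP + γ * ℕtoℚ (strayPairs S c))
              (≡.sym (no-brokenPairs c broken≡0)) (≡.sym broken≡0)
              (gain-from-strays 0<γ (ℕₚ.n≢0⇒n>0 stray≢0)))
      (optimal⇒no-gain {γ} {c} optimal)
    by-cases (yes broken≡0) (yes stray≡0) = component-cluster c broken≡0 stray≡0

lemma10 : ∀ {v : ℕ} (N : Network v) (S : VSet v) → IsComponent N S →
    ((γ : ℚ) → 0ℚ < γ → γ < 1ℚ → γ * ℕtoℚ (count S C 2) < 1ℚ →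
      (c : Clustering v) → IsOptimal γ N c → IsCluster c S)
    × Σ ℚ (λ ε → 0ℚ < ε × ((γ : ℚ) → 0ℚ < γ → γ < ε →
      (c : Clustering v) → IsOptimal γ N c → IsCluster c S))
lemma10 N S component =
  let ε , 0<ε , γ<ε⇒γK<1 = small-γ (count S C 2) in
  (λ γ 0<γ _ γK<1 → optimal⇒cluster N S component 0<γ γK<1) ,
  ε , 0<ε , λ γ 0<γ γ<ε → optimal⇒cluster N S component 0<γ (γ<ε⇒γK<1 γ 0<γ γ<ε)
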